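{- Let $G=(V,E)$ be a weighted multi-graph on $n$ vertices with integer edge weights in $\{1,\dots,W\}$ and capacities $\{b_v\}_{v\in V}$ (with no bound on the number of parallel edges), let $\overline{G}$ be its relevant subgraph, and let $M_G$ be a maximum weight $b$-matching of $G$. Then $|\overline{G}| \leq 2n \cdot |M_G|$.
   Context: A weighted multi-graph $G=(V,E)$ has a multi-set of weighted edges $(u,v,k)$ with $u\neq v$ and weight $k\in\{1,\dots,W\}$; each vertex $v$ has a positive integer capacity $b_v$; arbitrarily many parallel edges are allowed. The relevant edges between $u$ and $v$ are the $\min(b_u,b_v)$ edges of $G$ between $u$ and $v$ of largest weights (all of them if there are fewer); the relevant subgraph $\overline{G}$ consists of all relevant edges, and $|\overline{G}|$ is its number of edges. A $b$-matching is a multi-set $M$ of edges with at most $b_v$ edges of $M$ incident to each $v$; $|M|$ is its number of edges. -}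

module Defs where

open import Data.Nat using (ℕ; zero; suc; _+_; _*_; _≤_; _<_; _⊓_)
open import Data.Nat.Properties using (_<?_)
open import Data.Fin using (Fin; toℕ; _≟_)
open import Data.List using (List; []; _∷_; length; filter; map; allFin; concatMap)
open import Data.Nat.ListAction using (sum)
open import Data.List.Relation.Binary.Sublist.Propositional using (_⊆_)
open import Data.Product using (_×_)
open import Data.Sum using (_⊎_)
open import Relation.Binary.PropositionalEquality using (_≡_; _≢_)
open import Relation.Nullary using (Dec; yes; no; ¬_)
open import Relation.Nullary.Decidable using (_⊎-dec_; _×-dec_)

record Edge (n W : ℕ) : Set where
  constructor edge
  field
    u v    : Fin n
    u≢v    : u ≢ v
    weight : ℕ
    1≤w    : 1 ≤ weight
    w≤W    : weight ≤ W
open Edge public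

MultiGraph : ℕ → ℕ → Set
MultiGraph n W = List (Edge n W)

Capacities : ℕ → Set
Capacities n = Fin n → ℕ

incident? : ∀ {n W} (x : Fin n) (e : Edge n W) → Dec (u e ≡ x ⊎ v e ≡ x)
incident? x e = (u e ≟ x) ⊎-dec (v e ≟ x)

degree : ∀ {n W} → List (Edge n W) → Fin n → ℕ
degree M x = length (filter (incident? x) M)

totalWeight : ∀ {n W} → List (Edge n W) → ℕ
totalWeight M = sum (map weight M)

IsBMatching : ∀ {n W} → Capacities n → MultiGraph n W → List (Edge n W) → Set
IsBMatching {n} b G M = (M ⊆ G) × (∀ (x : Fin n) → degree M x ≤ b x)

IsMaxWeightBMatching : ∀ {n W} → Capacities n → MultiGraph n W → List (Edge n W) → Set
IsMaxWeightBMatching {n} {W} b G M =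
  IsBMatching b G M ×
  (∀ (M′ : List (Edge n W)) → IsBMatching b G M′ → totalWeight M′ ≤ totalWeight M)

between? : ∀ {n W} (x y : Fin n) (e : Edge n W) → Dec ((u e ≡ x × v e ≡ y) ⊎ (u e ≡ y × v e ≡ x))
between? x y e = ((u e ≟ x) ×-dec (v e ≟ y)) ⊎-dec ((u e ≟ y) ×-dec (v e ≟ x))

multiplicity : ∀ {n W} → MultiGraph n W → Fin n → Fin n → ℕ
multiplicity G x y = length (filter (between? x y) G)

-- number of relevant edges between x and y: the min(b_x, b_y) heaviest
-- edges between x and y, or all of them if there are fewer
relevantBetween : ∀ {n W} → Capacities n → MultiGraph n W → Fin n → Fin n → ℕ
relevantBetween b G x y = (b x ⊓ b y) ⊓ multiplicity G x y

pairs : (n : ℕ) → List (Fin n × Fin n)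
pairs n = concatMap (λ x → map (λ y → (x Data.Product., y))
            (filter (λ y → toℕ x <? toℕ y) (allFin n))) (allFin n)

relevantSize : ∀ {n W} → Capacities n → MultiGraph n W → ℕ
relevantSize {n} b G = sum (map (λ p → relevantBetween b G (Data.Product.proj₁ p) (Data.Product.proj₂ p)) (pairs n))

-- For every pair {x, y}, a maximum weight b-matching M either already uses
-- all parallel x–y edges of G, or saturates x or y: otherwise one missing
-- x–y edge could be added to M, giving a heavier b-matching. Hence the
-- relevant x–y edges number at most deg_M x + deg_M y. Summing over pairs,
-- every vertex lies in fewer than n pairs, and the degrees sum to 2|M|.
module Submission where

open import Defs
open import Data.Bool.Base using (if_then_else_)
open import Data.Empty using (⊥; ⊥-elim)
open import Data.Fin using (Fin; _≟_) renaming (zero to fzero; suc to fsuc)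
import Data.Fin.Properties as Fin
open import Data.List using (List; []; _∷_; _++_; length; filter; map; concatMap; allFin)
open import Data.List.Properties using (map-++; map-tabulate; length-tabulate; map-∘; filter-accept; filter-reject)
open import Data.List.Relation.Binary.Permutation.Propositional using (_↭_; ↭-refl; ↭-trans; prep; swap)
open import Data.List.Relation.Binary.Permutation.Propositional.Properties using (filter-↭; ↭-length; map⁺)
open import Data.List.Relation.Binary.Sublist.Propositional using (_⊆_; []; _∷_; _∷ʳ_; ⊆-refl)
open import Data.List.Relation.Binary.Sublist.Propositional.Properties using (filter⁺; length-mono-≤)
open import Data.Nat using (ℕ; suc; _+_; _*_; _≤_; _<_; z≤n; s≤s; s<s⁻¹)
open import Data.Nat.ListAction using (sum)
open import Data.Nat.ListAction.Properties using (sum-++; sum-↭)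
open import Data.Nat.Properties hiding (_≟_)
open import Algebra.Properties.CommutativeSemigroup +-commutativeSemigroup
  using () renaming (interchange to +-interchange)
open import Data.Product using (∃-syntax; _×_; _,_; proj₁; proj₂)
open import Data.Sum using (_⊎_; inj₁; inj₂)
open import Function using (id; _∘_)
open import Relation.Binary.PropositionalEquality
open import Relation.Nullary using (Dec; yes; no; does; contradiction)
open import Relation.Nullary.Decidable using (_⊎-dec_)
open import Relation.Unary using (Pred; Decidable)

∑ : ∀ {a} {A : Set a} → List A → (A → ℕ) → ℕ
∑ xs f = sum (map f xs)

syntax ∑ xs (λ x → e) = ∑[ x ∈ xs ] e

𝟙[_] : ∀ {p} {P : Set p} → Dec P → ℕ
𝟙[ d ] = if does d then 1 else 0

𝟙-⊎ : ∀ {p q} {P : Set p} {Q : Set q} (p? : Dec P) (q? : Dec Q) → 𝟙[ p? ⊎-dec q? ] ≤ 𝟙[ p? ] + 𝟙[ q? ]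
𝟙-⊎ (yes _) _ = s≤s z≤n
𝟙-⊎ (no _) _ = ≤-refl

𝟙-disjoint : ∀ {p q} {P : Set p} {Q : Set q} (p? : Dec P) (q? : Dec Q) → (P → Q → ⊥) → 𝟙[ p? ] + 𝟙[ q? ] ≤ 1
𝟙-disjoint (yes p) (yes q) p∧q = ⊥-elim (p∧q p q)
𝟙-disjoint (yes _) (no _) _ = ≤-refl
𝟙-disjoint (no _) (yes _) _ = ≤-refl
𝟙-disjoint (no _) (no _) _ = z≤n

module _ {a} {A : Set a} where

  ∑-cong : ∀ (xs : List A) {f g : A → ℕ} → (∀ x → f x ≡ g x) → ∑ xs f ≡ ∑ xs g
  ∑-cong [] f≡g = refl
  ∑-cong (x ∷ xs) f≡g = cong₂ _+_ (f≡g x) (∑-cong xs f≡g)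

  ∑-mono-≤ : ∀ (xs : List A) {f g : A → ℕ} → (∀ x → f x ≤ g x) → ∑ xs f ≤ ∑ xs g
  ∑-mono-≤ [] f≤g = z≤n
  ∑-mono-≤ (x ∷ xs) f≤g = +-mono-≤ (f≤g x) (∑-mono-≤ xs f≤g)

  ∑-distrib-+ : ∀ (xs : List A) (f g : A → ℕ) → ∑[ x ∈ xs ] (f x + g x) ≡ ∑ xs f + ∑ xs g
  ∑-distrib-+ [] f g = refl
  ∑-distrib-+ (x ∷ xs) f g = trans (cong ((f x + g x) +_) (∑-distrib-+ xs f g))
                                    (+-interchange (f x) (g x) (∑ xs f) (∑ xs g))

  *-distribˡ-∑ : ∀ (c : ℕ) (xs : List A) (f : A → ℕ) → c * ∑ xs f ≡ ∑[ x ∈ xs ] (c * f x)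
  *-distribˡ-∑ c [] f = *-zeroʳ c
  *-distribˡ-∑ c (x ∷ xs) f = trans (*-distribˡ-+ c (f x) (∑ xs f)) (cong (c * f x +_) (*-distribˡ-∑ c xs f))

  ∑-const : ∀ (xs : List A) (c : ℕ) → ∑[ x ∈ xs ] c ≡ length xs * c
  ∑-const [] c = refl
  ∑-const (x ∷ xs) c = cong (c +_) (∑-const xs c)

  ∑-zero : ∀ (xs : List A) → ∑[ x ∈ xs ] 0 ≡ 0
  ∑-zero [] = refl
  ∑-zero (x ∷ xs) = ∑-zero xs

  ∑-++ : ∀ (xs ys : List A) (f : A → ℕ) → ∑ (xs ++ ys) f ≡ ∑ xs f + ∑ ys f
  ∑-++ xs ys f = trans (cong sum (map-++ f xs ys)) (sum-++ (map f xs) (map f ys))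

  module _ {p} {P : Pred A p} (P? : Decidable P) where

    ∑-filter : ∀ (xs : List A) (f : A → ℕ) → ∑ (filter P? xs) f ≡ ∑[ x ∈ xs ] (𝟙[ P? x ] * f x)
    ∑-filter [] f = refl
    ∑-filter (x ∷ xs) f with P? x
    ... | yes _ = cong₂ _+_ (sym (+-identityʳ (f x))) (∑-filter xs f)
    ... | no _ = ∑-filter xs f

    length-filter≡∑𝟙 : ∀ (xs : List A) → length (filter P? xs) ≡ ∑[ x ∈ xs ] 𝟙[ P? x ]
    length-filter≡∑𝟙 [] = refl
    length-filter≡∑𝟙 (x ∷ xs) with P? x
    ... | yes _ = cong suc (length-filter≡∑𝟙 xs)
    ... | no _ = length-filter≡∑𝟙 xs

module _ {a b} {A : Set a} {B : Set b} where

  ∑-map : ∀ (h : A → B) (xs : List A) (f : B → ℕ) → ∑ (map h xs) f ≡ ∑[ x ∈ xs ] f (h x)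
  ∑-map h xs f = cong sum (sym (map-∘ xs))

  ∑-concatMap : ∀ (g : A → List B) (xs : List A) (f : B → ℕ) → ∑ (concatMap g xs) f ≡ ∑[ x ∈ xs ] ∑ (g x) f
  ∑-concatMap g [] f = refl
  ∑-concatMap g (x ∷ xs) f = trans (∑-++ (g x) (concatMap g xs) f) (cong (∑ (g x) f +_) (∑-concatMap g xs f))

  ∑-comm : ∀ (xs : List A) (ys : List B) (g : A → B → ℕ) → ∑[ x ∈ xs ] ∑[ y ∈ ys ] g x y ≡ ∑[ y ∈ ys ] ∑[ x ∈ xs ] g x y
  ∑-comm [] ys g = sym (∑-zero ys)
  ∑-comm (x ∷ xs) ys g = trans (cong (∑ ys (g x) +_) (∑-comm xs ys g))
                               (sym (∑-distrib-+ ys (g x) (λ y → ∑[ x′ ∈ xs ] g x′ y)))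

∑-allFin-suc : ∀ n (f : Fin (suc n) → ℕ) → ∑ (allFin (suc n)) f ≡ f fzero + ∑[ i ∈ allFin n ] f (fsuc i)
∑-allFin-suc n f = cong (λ fs → f fzero + sum fs) (trans (map-tabulate fsuc f) (sym (map-tabulate id (f ∘ fsuc))))

∑-𝟙-≟ : ∀ n (w : Fin n) → ∑[ x ∈ allFin n ] 𝟙[ w ≟ x ] ≡ 1
∑-𝟙-≟ (suc n) fzero = trans (∑-allFin-suc n (λ x → 𝟙[ fzero ≟ x ])) (cong suc (∑-zero (allFin n)))
∑-𝟙-≟ (suc n) (fsuc w) = trans (∑-allFin-suc n (λ x → 𝟙[ fsuc w ≟ x ])) (∑-𝟙-≟ n w)

∑-pairs : ∀ n (F : Fin n × Fin n → ℕ) →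
          ∑ (pairs n) F ≡ ∑[ x ∈ allFin n ] ∑[ y ∈ allFin n ] (𝟙[ x Fin.<? y ] * F (x , y))
∑-pairs n F = trans (∑-concatMap (λ x → map (x ,_) (above x)) V F)
                    (∑-cong V (λ x → trans (∑-map (x ,_) (above x) F) (∑-filter (x Fin.<?_) V (λ y → F (x , y)))))
  where
  V = allFin n
  above : Fin n → List (Fin n)
  above x = filter (x Fin.<?_) V

∑-pairs≤ : ∀ n (f : Fin n → ℕ) → ∑[ p ∈ pairs n ] (f (proj₁ p) + f (proj₂ p)) ≤ n * ∑ (allFin n) f
∑-pairs≤ n f = begin
    ∑[ p ∈ pairs n ] (f (proj₁ p) + f (proj₂ p))
  ≡⟨ ∑-pairs n (λ p → f (proj₁ p) + f (proj₂ p)) ⟩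
    ∑∑[ x , y ] (χ x y * (f x + f y))
  ≡⟨ ∑∑-distrib-+ (λ x y → *-distribˡ-+ (χ x y) (f x) (f y)) ⟩
    ∑∑[ x , y ] (χ x y * f x) + ∑∑[ x , y ] (χ x y * f y)
  ≡⟨ cong (∑∑[ x , y ] (χ x y * f x) +_) (∑-comm V V (λ x y → χ x y * f y)) ⟩
    ∑∑[ x , y ] (χ x y * f x) + ∑∑[ x , y ] (χ y x * f x)
  ≡⟨ ∑∑-distrib-+ (λ x y → *-distribʳ-+ (f x) (χ x y) (χ y x)) ⟨
    ∑∑[ x , y ] ((χ x y + χ y x) * f x)
  ≤⟨ ∑-mono-≤ V (λ x → ∑-mono-≤ V (λ y → χ-once x y)) ⟩
    ∑∑[ x , y ] f x
  ≡⟨ ∑-cong V (λ x → trans (∑-const V (f x)) (cong (_* f x) (length-tabulate {n = n} id))) ⟩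
    ∑[ x ∈ V ] (n * f x)
  ≡⟨ *-distribˡ-∑ n V f ⟨
    n * ∑ V f ∎
  where
  open ≤-Reasoning
  V = allFin n
  χ : Fin n → Fin n → ℕ
  χ x y = 𝟙[ x Fin.<? y ]
  ∑∑ : (Fin n → Fin n → ℕ) → ℕ
  ∑∑ g = ∑[ x ∈ V ] ∑[ y ∈ V ] g x y
  syntax ∑∑ (λ x y → e) = ∑∑[ x , y ] e
  ∑∑-distrib-+ : ∀ {g h k : Fin n → Fin n → ℕ} → (∀ x y → k x y ≡ g x y + h x y) → ∑∑ k ≡ ∑∑ g + ∑∑ h
  ∑∑-distrib-+ {g} {h} k≡g+h =
    trans (∑-cong V (λ x → trans (∑-cong V (k≡g+h x)) (∑-distrib-+ V (g x) (h x))))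
          (∑-distrib-+ V (λ x → ∑ V (g x)) (λ x → ∑ V (h x)))
  χ-once : ∀ x y → (χ x y + χ y x) * f x ≤ f x
  χ-once x y = ≤-trans (*-monoˡ-≤ (f x) (𝟙-disjoint (x Fin.<? y) (y Fin.<? x) <-asym)) (≤-reflexive (*-identityˡ (f x)))

module _ {a p} {A : Set a} {P : Pred A p} (P? : Decidable P) where

  length-filter-∷-cancel-< : ∀ x {xs ys : List A} →
    length (filter P? (x ∷ xs)) < length (filter P? (x ∷ ys)) → length (filter P? xs) < length (filter P? ys)
  length-filter-∷-cancel-< x lt with P? x
  ... | yes _ = s<s⁻¹ lt
  ... | no _ = lt

  ⊆-extend : ∀ {xs ys : List A} → xs ⊆ ys → length (filter P? xs) < length (filter P? ys) →
             ∃[ z ] P z × ∃[ zs ] zs ⊆ ys × zs ↭ z ∷ xs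
  ⊆-extend {xs} {y ∷ ys} (.y ∷ʳ τ) lt with length (filter P? xs) <? length (filter P? ys)
  ... | yes lt′ = let z , pz , zs , σ , π = ⊆-extend τ lt′ in z , pz , zs , y ∷ʳ σ , π
  ... | no ¬lt′ with P? y
  ...   | yes py = y , py , y ∷ xs , refl ∷ τ , ↭-refl
  ...   | no _ = contradiction lt ¬lt′
  ⊆-extend {x ∷ xs} (refl ∷ τ) lt with ⊆-extend τ (length-filter-∷-cancel-< x lt)
  ... | z , pz , zs , σ , π = z , pz , x ∷ zs , refl ∷ σ , ↭-trans (prep x π) (swap x z ↭-refl)

module _ {n W : ℕ} where

  degree-↭ : ∀ {M N : List (Edge n W)} → M ↭ N → ∀ x → degree M x ≡ degree N x
  degree-↭ π x = ↭-length (filter-↭ (incident? x) π)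

  totalWeight-↭ : ∀ {M N : List (Edge n W)} → M ↭ N → totalWeight M ≡ totalWeight N
  totalWeight-↭ π = sum-↭ (map⁺ weight π)

  ∑-degree≤2*length : ∀ (M : List (Edge n W)) → ∑ (allFin n) (degree M) ≤ 2 * length M
  ∑-degree≤2*length M = begin
      ∑[ x ∈ V ] degree M x
    ≡⟨ ∑-cong V (λ x → length-filter≡∑𝟙 (incident? x) M) ⟩
      ∑[ x ∈ V ] ∑[ e ∈ M ] 𝟙[ incident? x e ]
    ≡⟨ ∑-comm V M (λ x e → 𝟙[ incident? x e ]) ⟩
      ∑[ e ∈ M ] ∑[ x ∈ V ] 𝟙[ incident? x e ]
    ≤⟨ ∑-mono-≤ M (λ e → ∑-mono-≤ V (λ x → 𝟙-⊎ (u e ≟ x) (v e ≟ x))) ⟩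
      ∑[ e ∈ M ] ∑[ x ∈ V ] (𝟙[ u e ≟ x ] + 𝟙[ v e ≟ x ])
    ≡⟨ ∑-cong M (λ e → trans (∑-distrib-+ V _ _) (cong₂ _+_ (∑-𝟙-≟ n (u e)) (∑-𝟙-≟ n (v e)))) ⟩
      ∑[ e ∈ M ] 2
    ≡⟨ trans (∑-const M 2) (*-comm (length M) 2) ⟩
      2 * length M ∎
    where
    open ≤-Reasoning
    V = allFin n

  multiplicity≤degree : ∀ (M : List (Edge n W)) x y → multiplicity M x y ≤ degree M x
  multiplicity≤degree M x y = length-mono-≤ (filter⁺ (between? x y) (incident? x) between⇒incident (⊆-refl {x = M}))
    where
    between⇒incident : ∀ {e f : Edge n W} → e ≡ f → (u e ≡ x × v e ≡ y) ⊎ (u e ≡ y × v e ≡ x) → u f ≡ x ⊎ v f ≡ x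
    between⇒incident refl (inj₁ (ux , _)) = inj₁ ux
    between⇒incident refl (inj₂ (_ , vx)) = inj₂ vx

  endpoint-between : ∀ {x y z} (e : Edge n W) → (u e ≡ x × v e ≡ y) ⊎ (u e ≡ y × v e ≡ x) →
                     u e ≡ z ⊎ v e ≡ z → z ≡ x ⊎ z ≡ y
  endpoint-between e (inj₁ (refl , refl)) (inj₁ refl) = inj₁ refl
  endpoint-between e (inj₁ (refl , refl)) (inj₂ refl) = inj₂ refl
  endpoint-between e (inj₂ (refl , refl)) (inj₁ refl) = inj₂ refl
  endpoint-between e (inj₂ (refl , refl)) (inj₂ refl) = inj₁ refl

  module _ {b : Capacities n} {G : MultiGraph n W} where

    isBMatching-addEdge : ∀ {M M′ : List (Edge n W)} {e : Edge n W} → IsBMatching b G M → M′ ⊆ G → M′ ↭ e ∷ M →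
                          (∀ z → u e ≡ z ⊎ v e ≡ z → degree M z < b z) → IsBMatching b G M′
    isBMatching-addEdge {M} {e = e} (_ , degree≤b) σ π endpoints-free =
      σ , λ x → subst (_≤ b x) (sym (degree-↭ π x)) (degree-∷≤b x (incident? x e))
      where
      degree-∷≤b : ∀ x → Dec (u e ≡ x ⊎ v e ≡ x) → degree (e ∷ M) x ≤ b x
      degree-∷≤b x (yes incident) =
        subst (_≤ b x) (sym (cong length (filter-accept (incident? x) incident))) (endpoints-free x incident)
      degree-∷≤b x (no ¬incident) =
        subst (_≤ b x) (sym (cong length (filter-reject (incident? x) ¬incident))) (degree≤b x)

    maxWeight-exhausts-or-saturates : ∀ {M : List (Edge n W)} → IsMaxWeightBMatching b G M → ∀ x y →
      multiplicity G x y ≤ multiplicity M x y ⊎ b x ≤ degree M x ⊎ b y ≤ degree M y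
    maxWeight-exhausts-or-saturates {M} ((M⊆G , degree≤b) , maximal) x y
      with multiplicity G x y ≤? multiplicity M x y | degree M x <? b x | degree M y <? b y
    ... | yes exhausted | _ | _ = inj₁ exhausted
    ... | no _ | no x-saturated | _ = inj₂ (inj₁ (≮⇒≥ x-saturated))
    ... | no _ | yes _ | no y-saturated = inj₂ (inj₂ (≮⇒≥ y-saturated))
    ... | no missing | yes x-free | yes y-free
      with ⊆-extend (between? x y) M⊆G (≰⇒> missing)
    ...   | e , e-between , M′ , σ , π = contradiction heavier (≤⇒≯ (maximal M′ isBMatching′))
      where
      free : ∀ {z} → z ≡ x ⊎ z ≡ y → degree M z < b z
      free (inj₁ refl) = x-free
      free (inj₂ refl) = y-free
      isBMatching′ : IsBMatching b G M′
      isBMatching′ = isBMatching-addEdge (M⊆G , degree≤b) σ π (λ z → free ∘ endpoint-between e e-between)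
      heavier : totalWeight M < totalWeight M′
      heavier = subst (totalWeight M <_) (sym (totalWeight-↭ π)) (+-monoˡ-≤ (totalWeight M) (1≤w e))

    relevantBetween≤degree+degree : ∀ {M : List (Edge n W)} → IsMaxWeightBMatching b G M → ∀ x y →
                                    relevantBetween b G x y ≤ degree M x + degree M y
    relevantBetween≤degree+degree {M} mx x y with maxWeight-exhausts-or-saturates mx x y
    ... | inj₁ exhausted =
      ≤-trans (m⊓n≤n _ _) (≤-trans exhausted (≤-trans (multiplicity≤degree M x y) (m≤m+n _ _)))
    ... | inj₂ (inj₁ x-saturated) = ≤-trans (m⊓n≤m _ _) (≤-trans (m⊓n≤m _ _) (≤-trans x-saturated (m≤m+n _ _)))
    ... | inj₂ (inj₂ y-saturated) = ≤-trans (m⊓n≤m _ _) (≤-trans (m⊓n≤n _ _) (≤-trans y-saturated (m≤n+m _ _)))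

lemma38 : (n W : ℕ) (b : Capacities n) → (∀ (x : Fin n) → 0 < b x) →
          (G : MultiGraph n W) (M : List (Edge n W)) →
          IsMaxWeightBMatching b G M →
          relevantSize b G ≤ 2 * n * length M
lemma38 n W b _ G M mx = begin
    relevantSize b G
  ≤⟨ ∑-mono-≤ (pairs n) (λ (x , y) → relevantBetween≤degree+degree mx x y) ⟩
    ∑[ p ∈ pairs n ] (degree M (proj₁ p) + degree M (proj₂ p))
  ≤⟨ ∑-pairs≤ n (degree M) ⟩
    n * ∑ (allFin n) (degree M)
  ≤⟨ *-monoʳ-≤ n (∑-degree≤2*length M) ⟩
    n * (2 * length M)
  ≡⟨ *-assoc n 2 (length M) ⟨
    n * 2 * length M
  ≡⟨ cong (_* length M) (*-comm n 2) ⟩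
    2 * n * length M ∎
  where open ≤-Reasoning
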